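{- For $m\ge 3$ let $\Gamma_{2m}$ be the graph on vertices $v_1,v_1',\dots,v_m,v_m'$ whose edges are, for each $k=1,\dots,m$ (with indices taken modulo $m$, so $v_{m+1}=v_1$, $v_{m+1}'=v_1'$), the four edges $v_kv_{k+1}$, $v_kv_{k+1}'$, $v_k'v_{k+1}$, $v_k'v_{k+1}'$, each of unit resistance. (This is a $4$-regular graph on $2m$ vertices.) Then \[K\!f(\Gamma_{2m})=\frac{1}{12}(m^3+6m^2-m),\] equivalently, writing $N=2m$ for the number of vertices, $K\!f(\Gamma_N)=\frac{1}{96}(N^3+12N^2-4N)$ for even $N\ge 6$.
   Context: For a connected graph with unit edge resistances and Laplacian $L$, the resistance distance between vertices $u,v$ is $\Omega(u,v)=(\mathbf{e}_u-\mathbf{e}_v)^TL^{\dagger}(\mathbf{e}_u-\mathbf{e}_v)$, with $L^\dagger$ the Moore–Penrose inverse (the effective resistance in the resistor network). The Kirchhoff index is $K\!f=\sum_{\{u,v\}}\Omega(u,v)$ over all unordered pairs of distinct vertices. -}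

module Defs where

open import Data.Nat as ℕ using (ℕ; zero; suc; _%_)
import Data.Nat.Properties as ℕP
open import Data.Integer as ℤ using (ℤ; +_)
open import Data.Rational as ℚ using (ℚ; 0ℚ; 1ℚ; _+_; _*_; -_; _-_)
open import Data.Fin as Fin using (Fin; toℕ; remQuot)
open import Data.Bool using (Bool; true; false; if_then_else_; _∨_)
open import Data.Product using (proj₁; proj₂)
open import Relation.Nullary.Decidable using (⌊_⌋)
open import Relation.Binary.PropositionalEquality using (_≡_)
open import Data.Product using (_×_)

Vec : ℕ → Set
Vec n = Fin n → ℚ

Matrix : ℕ → Set
Matrix n = Fin n → Fin n → ℚ

Σ : ∀ n → (Fin n → ℚ) → ℚ
Σ zero    f = 0ℚ
Σ (suc n) f = f Fin.zero + Σ n (λ i → f (Fin.suc i))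

infixl 7 _⊗_
infix 4 _≈_
_⊗_ : ∀ {n} → Matrix n → Matrix n → Matrix n
_⊗_ {n} A B i j = Σ n (λ k → A i k * B k j)

transpose : ∀ {n} → Matrix n → Matrix n
transpose A i j = A j i

_≈_ : ∀ {n} → Matrix n → Matrix n → Set
A ≈ B = ∀ i j → A i j ≡ B i j

-- X is the Moore–Penrose inverse of L (real matrices: conjugate transpose = transpose)
IsMoorePenrose : ∀ {n} → Matrix n → Matrix n → Set
IsMoorePenrose L X =
  ((L ⊗ X) ⊗ L ≈ L) × ((X ⊗ L) ⊗ X ≈ X) ×
  (transpose (L ⊗ X) ≈ (L ⊗ X)) × (transpose (X ⊗ L) ≈ (X ⊗ L))

b2q : Bool → ℚ
b2q true  = 1ℚ
b2q false = 0ℚ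

laplacian : ∀ {n} → (Fin n → Fin n → Bool) → Matrix n
laplacian {n} adj i j =
  if ⌊ i Fin.≟ j ⌋ then Σ n (λ k → b2q (adj i k)) else - b2q (adj i j)

e : ∀ {n} → Fin n → Vec n
e u k = if ⌊ u Fin.≟ k ⌋ then 1ℚ else 0ℚ

quad : ∀ {n} → Matrix n → Vec n → ℚ
quad {n} X x = Σ n (λ i → Σ n (λ j → x i * X i j * x j))

resistance : ∀ {n} → Matrix n → Fin n → Fin n → ℚ
resistance X u v = quad X (λ k → e u k - e v k)

kirchhoff : ∀ {n} → Matrix n → ℚ
kirchhoff {n} X =
  Σ n (λ u → Σ n (λ v → if ⌊ toℕ u ℕ.<? toℕ v ⌋ then resistance X u v else 0ℚ))

-- The graph Γ_{2m}: vertex i ∈ Fin (m * 2) is (k , b) = remQuot 2 i,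
-- k ∈ Fin m the block index, b = 0 ↦ v_{k+1}, b = 1 ↦ v'_{k+1}.

Γadj : ∀ m → .{{ℕ.NonZero m}} → Fin (m ℕ.* 2) → Fin (m ℕ.* 2) → Bool
Γadj m x y =
  ⌊ toℕ ky ℕ.≟ (suc (toℕ kx) % m) ⌋ ∨ ⌊ toℕ kx ℕ.≟ (suc (toℕ ky) % m) ⌋
  where
    kx = proj₁ (remQuot {m} 2 x)
    ky = proj₁ (remQuot {m} 2 y)

Γ-laplacian : ∀ m → 3 ℕ.≤ m → Matrix (m ℕ.* 2)
Γ-laplacian m h = laplacian (Γadj m {{ℕ.>-nonZero (ℕP.≤-trans (ℕ.s≤s ℕ.z≤n) h)}})

{-# OPTIONS --safe #-}
-- Γ₂ₘ is the cycle Cₘ with every vertex doubled into two non-adjacent twins, so its Laplacian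
-- acts as 2 L_C on the twin-symmetric part and as the constant 4 on the twin-antisymmetric part.
-- Hence L_Γ† = ¼ L_C† ⊗ J₂ + ¼ I ⊗ (I₂ − ½ J₂), where L_C† has entry (m² − 1)/12m − t(m − t)/2m at
-- cyclic distance t. Rather than computing spectra, one checks this candidate X directly: it is
-- symmetric with zero row sums and L X = I − J/2m, which gives the four Penrose equations.
-- For such X the Kirchhoff index is n · tr X = 2m · 2m · (L_C†(0)/4 + 1/8) = (m³ + 6m² − m)/12.
module Submission where

open import Defs

module _ where
  open import Level using (0ℓ)
  open import Function using (_∘_; _⇔_; mk⇔)
  open import Data.Bool using (Bool; true; false; if_then_else_; _∨_)
  open import Data.Bool.Properties using (∨-comm)
  open import Data.Empty using (⊥-elim)
  open import Relation.Nullary.Negation using (¬_)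
  open import Data.Product using (_×_; _,_; proj₁; proj₂)
  open import Data.Sum using (_⊎_; inj₁; inj₂)
  open import Data.Nat as ℕ using (ℕ; zero; suc; _∸_; _%_; ∣_-_∣)
  import Data.Nat.Properties as ℕ
  open import Data.Nat.DivMod using (m%n<n; m<n⇒m%n≡m; n%n≡0)
  open import Data.Fin as Fin using (Fin; zero; suc; toℕ; fromℕ<; inject₁; combine; remQuot; _↑ˡ_; _↑ʳ_)
  import Data.Fin.Properties as Fin
  open import Data.Integer as ℤ using (ℤ; +_)
  import Data.Integer.Properties as ℤ
  open import Data.Integer.Tactic.RingSolver as ℤ-Solver using ()
  open import Data.Rational as ℚ using (ℚ; 0ℚ; 1ℚ; ½; _+_; _*_; -_; _-_; _/_; 1/_)
  open import Data.Rational.Literals using (fromℤ)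
  import Data.Rational.Properties as ℚ
  import Data.Rational.Unnormalised as ℚᵘ
  import Data.Rational.Unnormalised.Properties as ℚᵘ
  open import Algebra.Bundles using (Ring)
  open import Algebra.Properties.Semiring.Sum (Ring.semiring ℚ.+-*-ring)
    using (sum; sum-cong-≗; ∑-distrib-+; ∑-comm; *-distribˡ-sum; sum-init-last; sum-replicate-zero)
  open import Relation.Nullary.Decidable using (Dec; _×-dec_; dec⇒maybe; does-⇔; isYes≗does; ⌊_⌋; yes; no)
  open import Relation.Binary.PropositionalEquality
  open import Tactic.RingSolver using (solve-∀)
  open import Tactic.RingSolver.Core.AlmostCommutativeRing using (AlmostCommutativeRing; fromCommutativeRing)
  open ≡-Reasoning

  ℚ-ring : AlmostCommutativeRing 0ℓ 0ℓ
  ℚ-ring = fromCommutativeRing ℚ.+-*-commutativeRing (λ x → dec⇒maybe (0ℚ ℚ.≟ x))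

  fromℕ : ℕ → ℚ
  fromℕ n = fromℤ (+ n)

  fromℤ-+ : ∀ x y → fromℤ (x ℤ.+ y) ≡ fromℤ x + fromℤ y
  fromℤ-+ x y = ℚ.toℚᵘ-injective (ℚᵘ.≃-sym (ℚᵘ.≃-trans (ℚ.toℚᵘ-homo-+ (fromℤ x) (fromℤ y)) (ℚᵘ.*≡* (eq x y))))
    where
    eq : ∀ x y → (x ℤ.* + 1 ℤ.+ y ℤ.* + 1) ℤ.* + 1 ≡ (x ℤ.+ y) ℤ.* (+ 1 ℤ.* + 1)
    eq = ℤ-Solver.solve-∀

  fromℤ-neg : ∀ x → fromℤ (ℤ.- x) ≡ - fromℤ x
  fromℤ-neg x = ℚ.toℚᵘ-injective (ℚᵘ.≃-sym (ℚ.toℚᵘ-homo‿- (fromℤ x)))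

  fromℤ-sub : ∀ x y → fromℤ (x ℤ.- y) ≡ fromℤ x - fromℤ y
  fromℤ-sub x y = trans (fromℤ-+ x (ℤ.- y)) (cong (_+_ (fromℤ x)) (fromℤ-neg y))

  fromℤ-* : ∀ x y → fromℤ (x ℤ.* y) ≡ fromℤ x * fromℤ y
  fromℤ-* x y = ℚ.toℚᵘ-injective (ℚᵘ.≃-sym (ℚᵘ.≃-trans (ℚ.toℚᵘ-homo-* (fromℤ x) (fromℤ y)) (ℚᵘ.*≡* (eq x y))))
    where
    eq : ∀ x y → (x ℤ.* y) ℤ.* + 1 ≡ (x ℤ.* y) ℤ.* (+ 1 ℤ.* + 1)
    eq = ℤ-Solver.solve-∀

  /-as-* : ∀ z d → z / suc d ≡ fromℤ z * (+ 1 / suc d)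
  /-as-* z d = ℚ.toℚᵘ-injective (ℚᵘ.≃-trans (ℚ.toℚᵘ-fromℚᵘ (ℚᵘ.mkℚᵘ z d)) (ℚᵘ.≃-sym (ℚᵘ.≃-trans
    (ℚ.toℚᵘ-homo-* (fromℤ z) (+ 1 / suc d)) (ℚᵘ.≃-trans (ℚᵘ.*-congˡ (ℚ.toℚᵘ-fromℚᵘ (ℚᵘ.mkℚᵘ (+ 1) d))) (ℚᵘ.*≡* (eq z (+ suc d)))))))
    where
    eq : ∀ z n → (z ℤ.* + 1) ℤ.* n ≡ z ℤ.* (+ 1 ℤ.* n)
    eq = ℤ-Solver.solve-∀

  fromℕ-+ : ∀ a b → fromℕ (a ℕ.+ b) ≡ fromℕ a + fromℕ b
  fromℕ-+ a b = fromℤ-+ (+ a) (+ b)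

  fromℕ-* : ∀ a b → fromℕ (a ℕ.* b) ≡ fromℕ a * fromℕ b
  fromℕ-* a b = trans (cong fromℤ (ℤ.pos-* a b)) (fromℤ-* (+ a) (+ b))

  fromℕ-suc : ∀ n → fromℕ (suc n) ≡ 1ℚ + fromℕ n
  fromℕ-suc n = fromℕ-+ 1 n

  b2q-if : ∀ b → (if b then 1ℚ else 0ℚ) ≡ b2q b
  b2q-if true  = refl
  b2q-if false = refl

  b2q-×-dec : ∀ {a b} {A : Set a} {B : Set b} (a? : Dec A) (b? : Dec B) →
    b2q ⌊ a? ×-dec b? ⌋ ≡ b2q ⌊ a? ⌋ * b2q ⌊ b? ⌋
  b2q-×-dec (yes _) (yes _) = refl
  b2q-×-dec (yes _) (no _)  = refl
  b2q-×-dec (no _)  (yes _) = refl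
  b2q-×-dec (no _)  (no _)  = refl

  b2q-∨ : ∀ {a b} {A : Set a} {B : Set b} (a? : Dec A) (b? : Dec B) → ¬ (A × B) →
    b2q (⌊ a? ⌋ ∨ ⌊ b? ⌋) ≡ b2q ⌊ a? ⌋ + b2q ⌊ b? ⌋
  b2q-∨ (yes a) (yes b) ¬a×b = ⊥-elim (¬a×b (a , b))
  b2q-∨ (yes _) (no _)  _    = refl
  b2q-∨ (no _)  (yes _) _    = refl
  b2q-∨ (no _)  (no _)  _    = refl

  ⌊⌋-⇔ : ∀ {a b} {A : Set a} {B : Set b} → A ⇔ B → (a? : Dec A) (b? : Dec B) → ⌊ a? ⌋ ≡ ⌊ b? ⌋
  ⌊⌋-⇔ A⇔B a? b? = trans (isYes≗does a?) (trans (does-⇔ A⇔B a? b?) (sym (isYes≗does b?)))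

  ⌊suc≟suc⌋ : ∀ x y → ⌊ suc x ℕ.≟ suc y ⌋ ≡ ⌊ x ℕ.≟ y ⌋
  ⌊suc≟suc⌋ x y = ⌊⌋-⇔ (mk⇔ ℕ.suc-injective (cong suc)) (suc x ℕ.≟ suc y) (x ℕ.≟ y)

  e-does : ∀ {n} (u k : Fin n) → e u k ≡ b2q ⌊ u Fin.≟ k ⌋
  e-does u k = b2q-if ⌊ u Fin.≟ k ⌋

  e-sym : ∀ {n} (u v : Fin n) → e u v ≡ e v u
  e-sym u v = begin
    e u v                  ≡⟨ e-does u v ⟩
    b2q ⌊ u Fin.≟ v ⌋      ≡⟨ cong b2q (⌊⌋-⇔ (mk⇔ sym sym) (u Fin.≟ v) (v Fin.≟ u)) ⟩
    b2q ⌊ v Fin.≟ u ⌋      ≡⟨ sym (e-does v u) ⟩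
    e v u                  ∎

  e-refl : ∀ {n} (u : Fin n) → e u u ≡ 1ℚ
  e-refl u with u Fin.≟ u
  ... | yes _  = refl
  ... | no u≢u = ⊥-elim (u≢u refl)

  e-toℕ : ∀ {n} (a c : Fin n) → e a c ≡ b2q ⌊ toℕ a ℕ.≟ toℕ c ⌋
  e-toℕ a c = trans (e-does a c) (cong b2q (⌊⌋-⇔ (mk⇔ (cong toℕ) Fin.toℕ-injective) (a Fin.≟ c) (toℕ a ℕ.≟ toℕ c)))

  Σ≡sum : ∀ n (f : Fin n → ℚ) → Σ n f ≡ sum f
  Σ≡sum zero    f = refl
  Σ≡sum (suc n) f = cong (_+_ (f zero)) (Σ≡sum n (f ∘ suc))

  Σ-cong : ∀ n {f g : Fin n → ℚ} → (∀ i → f i ≡ g i) → Σ n f ≡ Σ n g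
  Σ-cong n {f} {g} f≗g rewrite Σ≡sum n f | Σ≡sum n g = sum-cong-≗ f≗g

  Σ-distrib-+ : ∀ n (f g : Fin n → ℚ) → Σ n (λ i → f i + g i) ≡ Σ n f + Σ n g
  Σ-distrib-+ n f g rewrite Σ≡sum n f | Σ≡sum n g | Σ≡sum n (λ i → f i + g i) = ∑-distrib-+ f g

  Σ-neg : ∀ n (f : Fin n → ℚ) → Σ n (λ i → - f i) ≡ - Σ n f
  Σ-neg zero    f = refl
  Σ-neg (suc n) f = trans (cong (_+_ (- f zero)) (Σ-neg n (f ∘ suc))) (sym (ℚ.neg-distrib-+ (f zero) (Σ n (f ∘ suc))))

  Σ-distrib-sub : ∀ n (f g : Fin n → ℚ) → Σ n (λ i → f i - g i) ≡ Σ n f - Σ n g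
  Σ-distrib-sub n f g = trans (Σ-distrib-+ n f (λ i → - g i)) (cong (_+_ (Σ n f)) (Σ-neg n g))

  *-distribˡ-Σ : ∀ n c (f : Fin n → ℚ) → c * Σ n f ≡ Σ n (λ i → c * f i)
  *-distribˡ-Σ n c f rewrite Σ≡sum n f | Σ≡sum n (λ i → c * f i) = *-distribˡ-sum c f

  Σ-comm : ∀ n p (f : Fin n → Fin p → ℚ) → Σ n (λ i → Σ p (f i)) ≡ Σ p (λ j → Σ n (λ i → f i j))
  Σ-comm n p f = begin
    Σ n (λ i → Σ p (f i))          ≡⟨ Σ-cong n (λ i → Σ≡sum p (f i)) ⟩
    Σ n (λ i → sum (f i))          ≡⟨ Σ≡sum n _ ⟩
    sum (λ i → sum (f i))          ≡⟨ ∑-comm f ⟩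
    sum (λ j → sum (λ i → f i j))  ≡⟨ sym (Σ≡sum p _) ⟩
    Σ p (λ j → sum (λ i → f i j))  ≡⟨ sym (Σ-cong p (λ j → Σ≡sum n (λ i → f i j))) ⟩
    Σ p (λ j → Σ n (λ i → f i j))  ∎

  Σ-zero : ∀ n → Σ n (λ _ → 0ℚ) ≡ 0ℚ
  Σ-zero n = trans (Σ≡sum n (λ _ → 0ℚ)) (sum-replicate-zero n)

  Σ-const : ∀ n c → Σ n (λ _ → c) ≡ fromℕ n * c
  Σ-const zero    c = sym (ℚ.*-zeroˡ c)
  Σ-const (suc n) c = begin
    c + Σ n (λ _ → c)       ≡⟨ cong (_+_ c) (Σ-const n c) ⟩
    c + fromℕ n * c         ≡⟨ distrib (fromℕ n) c ⟩
    (1ℚ + fromℕ n) * c      ≡⟨ cong (_* c) (sym (fromℕ-suc n)) ⟩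
    fromℕ (suc n) * c       ∎
    where
    distrib : ∀ x c → c + x * c ≡ (1ℚ + x) * c
    distrib = solve-∀ ℚ-ring

  Σ-last : ∀ n (f : Fin (suc n) → ℚ) → Σ (suc n) f ≡ Σ n (f ∘ inject₁) + f (Fin.fromℕ n)
  Σ-last n f rewrite Σ≡sum (suc n) f | Σ≡sum n (f ∘ inject₁) = sum-init-last f

  Σ-toℕ-last : ∀ n (g : ℕ → ℚ) → Σ (suc n) (λ c → g (toℕ c)) ≡ Σ n (λ c → g (toℕ c)) + g n
  Σ-toℕ-last n g = trans (Σ-last n (λ c → g (toℕ c)))
    (cong₂ _+_ (Σ-cong n (λ c → cong g (Fin.toℕ-inject₁ c))) (cong g (Fin.toℕ-fromℕ n)))

  Σ-↑ : ∀ n p (f : Fin (n ℕ.+ p) → ℚ) → Σ (n ℕ.+ p) f ≡ Σ n (λ i → f (i ↑ˡ p)) + Σ p (λ j → f (n ↑ʳ j))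
  Σ-↑ zero    p f = sym (ℚ.+-identityˡ (Σ p f))
  Σ-↑ (suc n) p f = trans (cong (_+_ (f zero)) (Σ-↑ n p (f ∘ suc)))
    (sym (ℚ.+-assoc (f zero) (Σ n (λ i → f (suc i ↑ˡ p))) (Σ p (λ j → f (suc n ↑ʳ j)))))

  Σ-combine : ∀ m n (f : Fin (m ℕ.* n) → ℚ) → Σ (m ℕ.* n) f ≡ Σ m (λ i → Σ n (λ j → f (combine i j)))
  Σ-combine zero    n f = refl
  Σ-combine (suc m) n f = trans (Σ-↑ n (m ℕ.* n) f)
    (cong (_+_ (Σ n (λ j → f (combine {suc m} zero j)))) (Σ-combine m n (λ k → f (n ↑ʳ k))))

  Σ-δ : ∀ n (u : Fin n) (f : Fin n → ℚ) → Σ n (λ k → e u k * f k) ≡ f u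
  Σ-δ (suc n) zero    f = begin
    1ℚ * f zero + Σ n (λ k → 0ℚ * f (suc k))  ≡⟨ cong₂ _+_ (ℚ.*-identityˡ (f zero)) (Σ-cong n (λ k → ℚ.*-zeroˡ (f (suc k)))) ⟩
    f zero + Σ n (λ _ → 0ℚ)                   ≡⟨ cong (_+_ (f zero)) (Σ-zero n) ⟩
    f zero + 0ℚ                               ≡⟨ ℚ.+-identityʳ (f zero) ⟩
    f zero                                    ∎
  Σ-δ (suc n) (suc u) f =
    trans (cong₂ _+_ (ℚ.*-zeroˡ (f zero)) (trans (Σ-cong n (λ k → cong (_* f (suc k)) (e-suc u k))) (Σ-δ n u (f ∘ suc))))
      (ℚ.+-identityˡ (f (suc u)))
    where
    e-suc : ∀ {n} (u k : Fin n) → e (suc u) (suc k) ≡ e u k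
    e-suc u k with u Fin.≟ k
    ... | yes _ = refl
    ... | no _  = refl

  Σ-e-difference : ∀ n (u v : Fin n) (f : Fin n → ℚ) → Σ n (λ k → f k * (e u k - e v k)) ≡ f u - f v
  Σ-e-difference n u v f = begin
    Σ n (λ k → f k * (e u k - e v k))                  ≡⟨ Σ-cong n (λ k → expand (f k) (e u k) (e v k)) ⟩
    Σ n (λ k → e u k * f k - e v k * f k)              ≡⟨ Σ-distrib-sub n (λ k → e u k * f k) (λ k → e v k * f k) ⟩
    Σ n (λ k → e u k * f k) - Σ n (λ k → e v k * f k)  ≡⟨ cong₂ _-_ (Σ-δ n u f) (Σ-δ n v f) ⟩
    f u - f v                                          ∎
    where
    expand : ∀ a x y → a * (x - y) ≡ x * a - y * a
    expand = solve-∀ ℚ-ring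

  -- Penrose equations and Laplacians

  centring : ∀ {n} → ℚ → Matrix n
  centring w i j = e i j - w

  centring-⊗ : ∀ {n} w (A : Matrix n) → (∀ j → Σ n (λ l → A l j) ≡ 0ℚ) → centring w ⊗ A ≈ A
  centring-⊗ {n} w A columns i j = begin
    Σ n (λ l → (e i l - w) * A l j)                    ≡⟨ Σ-cong n (λ l → expand (e i l) w (A l j)) ⟩
    Σ n (λ l → e i l * A l j - w * A l j)              ≡⟨ Σ-distrib-sub n (λ l → e i l * A l j) (λ l → w * A l j) ⟩
    Σ n (λ l → e i l * A l j) - Σ n (λ l → w * A l j)  ≡⟨ cong₂ _-_ (Σ-δ n i (λ l → A l j)) (sym (*-distribˡ-Σ n w (λ l → A l j))) ⟩
    A i j - w * Σ n (λ l → A l j)                      ≡⟨ cong (λ s → A i j - w * s) (columns j) ⟩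
    A i j - w * 0ℚ                                     ≡⟨ cancel (A i j) w ⟩
    A i j                                              ∎
    where
    expand : ∀ x w a → (x - w) * a ≡ x * a - w * a
    expand = solve-∀ ℚ-ring
    cancel : ∀ a w → a - w * 0ℚ ≡ a
    cancel = solve-∀ ℚ-ring

  ⊗-congˡ : ∀ {n} {A B : Matrix n} (C : Matrix n) → A ≈ B → A ⊗ C ≈ B ⊗ C
  ⊗-congˡ {n} C A≈B i j = Σ-cong n (λ l → cong (_* C l j) (A≈B i l))

  transpose-⊗ : ∀ {n} {A B : Matrix n} → transpose A ≈ A → transpose B ≈ B → transpose (A ⊗ B) ≈ B ⊗ A
  transpose-⊗ {n} {A} {B} A-sym B-sym i j =
    Σ-cong n (λ l → trans (cong₂ _*_ (A-sym l j) (B-sym i l)) (ℚ.*-comm (A l j) (B i l)))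

  -- (I − wJ) A = A whenever the columns of A sum to zero, so L X = X L = I − wJ gives all four equations.
  isMoorePenrose-centring : ∀ {n} {L X : Matrix n} w → transpose L ≈ L → transpose X ≈ X →
    (∀ j → Σ n (λ l → L l j) ≡ 0ℚ) → (∀ j → Σ n (λ l → X l j) ≡ 0ℚ) →
    L ⊗ X ≈ centring w → IsMoorePenrose L X
  isMoorePenrose-centring {n} {L} {X} w L-sym X-sym L-columns X-columns LX≈C =
    (λ i j → trans (⊗-congˡ L LX≈C i j) (centring-⊗ w L L-columns i j)) ,
    (λ i j → trans (⊗-congˡ X XL≈C i j) (centring-⊗ w X X-columns i j)) ,
    symmetric-if-centring LX≈C ,
    symmetric-if-centring XL≈C
    where
    symmetric-if-centring : {A : Matrix n} → A ≈ centring w → transpose A ≈ A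
    symmetric-if-centring A≈C i j = trans (A≈C j i) (trans (cong (_- w) (e-sym j i)) (sym (A≈C i j)))
    XL≈C : X ⊗ L ≈ centring w
    XL≈C i j = trans (sym (transpose-⊗ L-sym X-sym i j)) (trans (LX≈C j i) (cong (_- w) (e-sym j i)))

  degree : ∀ {n} → (Fin n → Fin n → Bool) → Fin n → ℚ
  degree {n} adj i = Σ n (λ k → b2q (adj i k))

  Σ-laplacian : ∀ {n} (adj : Fin n → Fin n → Bool) i (g : Fin n → ℚ) → adj i i ≡ false →
    Σ n (λ l → laplacian adj i l * g l) ≡ degree adj i * g i - Σ n (λ l → b2q (adj i l) * g l)
  Σ-laplacian {n} adj i g loopless = begin
    Σ n (λ l → laplacian adj i l * g l)
      ≡⟨ Σ-cong n entry ⟩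
    Σ n (λ l → e i l * (degree adj i * g l) - b2q (adj i l) * g l)
      ≡⟨ Σ-distrib-sub n (λ l → e i l * (degree adj i * g l)) (λ l → b2q (adj i l) * g l) ⟩
    Σ n (λ l → e i l * (degree adj i * g l)) - Σ n (λ l → b2q (adj i l) * g l)
      ≡⟨ cong (_- Σ n (λ l → b2q (adj i l) * g l)) (Σ-δ n i (λ l → degree adj i * g l)) ⟩
    degree adj i * g i - Σ n (λ l → b2q (adj i l) * g l)
      ∎
    where
    diagonal : ∀ x y → x ≡ 1ℚ * x - 0ℚ * y
    diagonal = solve-∀ ℚ-ring
    off-diagonal : ∀ b y x → - b * y ≡ 0ℚ * x - b * y
    off-diagonal = solve-∀ ℚ-ring
    entry : ∀ l → laplacian adj i l * g l ≡ e i l * (degree adj i * g l) - b2q (adj i l) * g l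
    entry l with i Fin.≟ l
    ... | yes refl rewrite loopless = diagonal (degree adj i * g i) (g i)
    ... | no _ = off-diagonal (b2q (adj i l)) (g l) (degree adj i * g l)

  laplacian-symmetric : ∀ {n} (adj : Fin n → Fin n → Bool) → (∀ i j → adj i j ≡ adj j i) →
    transpose (laplacian adj) ≈ laplacian adj
  laplacian-symmetric adj adj-sym i j with i Fin.≟ j | j Fin.≟ i
  ... | yes refl | yes _   = refl
  ... | yes refl | no j≢i  = ⊥-elim (j≢i refl)
  ... | no i≢j   | yes j≡i = ⊥-elim (i≢j (sym j≡i))
  ... | no _     | no _    = cong (λ b → - b2q b) (adj-sym j i)

  laplacian-rows : ∀ {n} (adj : Fin n → Fin n → Bool) i → adj i i ≡ false → Σ n (laplacian adj i) ≡ 0ℚ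
  laplacian-rows {n} adj i loopless = begin
    Σ n (laplacian adj i)                                    ≡⟨ Σ-cong n (λ l → sym (ℚ.*-identityʳ _)) ⟩
    Σ n (λ l → laplacian adj i l * 1ℚ)                       ≡⟨ Σ-laplacian adj i (λ _ → 1ℚ) loopless ⟩
    degree adj i * 1ℚ - Σ n (λ l → b2q (adj i l) * 1ℚ)       ≡⟨ cong (_-_ (degree adj i * 1ℚ)) (Σ-cong n (λ l → ℚ.*-identityʳ _)) ⟩
    degree adj i * 1ℚ - degree adj i                         ≡⟨ cancel (degree adj i) ⟩
    0ℚ                                                       ∎
    where
    cancel : ∀ x → x * 1ℚ - x ≡ 0ℚ
    cancel = solve-∀ ℚ-ring

  -- Resistance distance and Kirchhoff index

  resistance-entries : ∀ {n} (X : Matrix n) u v → resistance X u v ≡ (X u u - X u v) - (X v u - X v v)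
  resistance-entries {n} X u v = begin
    Σ n (λ i → Σ n (λ j → x i * X i j * x j))  ≡⟨ Σ-cong n (λ i → Σ-e-difference n u v (λ j → x i * X i j)) ⟩
    Σ n (λ i → x i * X i u - x i * X i v)      ≡⟨ Σ-cong n (λ i → factor (x i) (X i u) (X i v)) ⟩
    Σ n (λ i → (X i u - X i v) * x i)          ≡⟨ Σ-e-difference n u v (λ i → X i u - X i v) ⟩
    (X u u - X u v) - (X v u - X v v)          ∎
    where
    x : Fin n → ℚ
    x k = e u k - e v k
    factor : ∀ a b c → a * b - a * c ≡ (b - c) * a
    factor = solve-∀ ℚ-ring

  strictUpper : ∀ {n} → Matrix n → Matrix n
  strictUpper g u v = if ⌊ toℕ u ℕ.<? toℕ v ⌋ then g u v else 0ℚ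

  Σ²-strictUpper : ∀ n (g : Matrix n) → transpose g ≈ g → (∀ u → g u u ≡ 0ℚ) →
    Σ n (λ u → Σ n (g u)) ≡ Σ n (λ u → Σ n (strictUpper g u)) + Σ n (λ u → Σ n (strictUpper g u))
  Σ²-strictUpper n g g-sym g-diag = begin
    Σ n (λ u → Σ n (g u))
      ≡⟨ Σ-cong n (λ u → trans (Σ-cong n (split u)) (Σ-distrib-+ n (U u) (λ v → U v u))) ⟩
    Σ n (λ u → Σ n (U u) + Σ n (λ v → U v u))
      ≡⟨ Σ-distrib-+ n (λ u → Σ n (U u)) (λ u → Σ n (λ v → U v u)) ⟩
    Σ n (λ u → Σ n (U u)) + Σ n (λ u → Σ n (λ v → U v u))
      ≡⟨ cong (_+_ (Σ n (λ u → Σ n (U u)))) (Σ-comm n n (λ u v → U v u)) ⟩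
    Σ n (λ u → Σ n (U u)) + Σ n (λ v → Σ n (U v))
      ∎
    where
    U : Matrix n
    U = strictUpper g
    split : ∀ u v → g u v ≡ U u v + U v u
    split u v with toℕ u ℕ.<? toℕ v | toℕ v ℕ.<? toℕ u
    ... | yes u<v | yes v<u = ⊥-elim (ℕ.<-asym u<v v<u)
    ... | yes _   | no _    = sym (ℚ.+-identityʳ (g u v))
    ... | no _    | yes _   = trans (sym (g-sym u v)) (sym (ℚ.+-identityˡ (g v u)))
    ... | no u≮v  | no v≮u  = trans (cong (λ w → g w v) (Fin.toℕ-injective (ℕ.≤-antisym (ℕ.≮⇒≥ v≮u) (ℕ.≮⇒≥ u≮v)))) (g-diag v)

  kirchhoff-doubled : ∀ {n} (X : Matrix n) → kirchhoff X + kirchhoff X ≡ Σ n (λ u → Σ n (resistance X u))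
  kirchhoff-doubled {n} X = sym (Σ²-strictUpper n (resistance X) symmetric diagonal)
    where
    swap : ∀ a b c d → (d - c) - (b - a) ≡ (a - b) - (c - d)
    swap = solve-∀ ℚ-ring
    cancel : ∀ a → (a - a) - (a - a) ≡ 0ℚ
    cancel = solve-∀ ℚ-ring
    symmetric : transpose (resistance X) ≈ resistance X
    symmetric u v = begin
      resistance X v u                   ≡⟨ resistance-entries X v u ⟩
      (X v v - X v u) - (X u v - X u u)  ≡⟨ swap (X u u) (X u v) (X v u) (X v v) ⟩
      (X u u - X u v) - (X v u - X v v)  ≡⟨ sym (resistance-entries X u v) ⟩
      resistance X u v                   ∎
    diagonal : ∀ u → resistance X u u ≡ 0ℚ
    diagonal u = trans (resistance-entries X u u) (cancel (X u u))

  trace : ∀ {n} → Matrix n → ℚ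
  trace {n} X = Σ n (λ i → X i i)

  Σ-resistance : ∀ {n} (X : Matrix n) u → Σ n (X u) ≡ 0ℚ →
    Σ n (resistance X u) ≡ (fromℕ n * X u u + trace X) - Σ n (λ v → X v u)
  Σ-resistance {n} X u row = begin
    Σ n (resistance X u)
      ≡⟨ Σ-cong n (λ v → trans (resistance-entries X u v) (regroup (X u u) (X u v) (X v u) (X v v))) ⟩
    Σ n (λ v → ((X u u + X v v) - X u v) - X v u)
      ≡⟨ Σ-distrib-sub n (λ v → (X u u + X v v) - X u v) (λ v → X v u) ⟩
    Σ n (λ v → (X u u + X v v) - X u v) - Σ n (λ v → X v u)
      ≡⟨ cong (_- Σ n (λ v → X v u)) (Σ-distrib-sub n (λ v → X u u + X v v) (X u)) ⟩
    (Σ n (λ v → X u u + X v v) - Σ n (X u)) - Σ n (λ v → X v u)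
      ≡⟨ cong (λ s → (s - Σ n (X u)) - Σ n (λ v → X v u)) (Σ-distrib-+ n (λ _ → X u u) (λ v → X v v)) ⟩
    ((Σ n (λ _ → X u u) + trace X) - Σ n (X u)) - Σ n (λ v → X v u)
      ≡⟨ cong₂ (λ s t → ((s + trace X) - t) - Σ n (λ v → X v u)) (Σ-const n (X u u)) row ⟩
    ((fromℕ n * X u u + trace X) - 0ℚ) - Σ n (λ v → X v u)
      ≡⟨ cong (_- Σ n (λ v → X v u)) (ℚ.+-identityʳ (fromℕ n * X u u + trace X)) ⟩
    (fromℕ n * X u u + trace X) - Σ n (λ v → X v u)
      ∎
    where
    regroup : ∀ a b c d → (a - b) - (c - d) ≡ ((a + d) - b) - c
    regroup = solve-∀ ℚ-ring

  kirchhoff-trace : ∀ {n} (X : Matrix n) → (∀ u → Σ n (X u) ≡ 0ℚ) → kirchhoff X ≡ fromℕ n * trace X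
  kirchhoff-trace {n} X rows = halve (begin
    kirchhoff X + kirchhoff X
      ≡⟨ kirchhoff-doubled X ⟩
    Σ n (λ u → Σ n (resistance X u))
      ≡⟨ Σ-cong n (λ u → Σ-resistance X u (rows u)) ⟩
    Σ n (λ u → (fromℕ n * X u u + trace X) - Σ n (λ v → X v u))
      ≡⟨ Σ-distrib-sub n (λ u → fromℕ n * X u u + trace X) (λ u → Σ n (λ v → X v u)) ⟩
    Σ n (λ u → fromℕ n * X u u + trace X) - Σ n (λ u → Σ n (λ v → X v u))
      ≡⟨ cong₂ _-_ (Σ-distrib-+ n (λ u → fromℕ n * X u u) (λ _ → trace X)) columns ⟩
    (Σ n (λ u → fromℕ n * X u u) + Σ n (λ _ → trace X)) - 0ℚ
      ≡⟨ cong₂ (λ s t → (s + t) - 0ℚ) (sym (*-distribˡ-Σ n (fromℕ n) (λ u → X u u))) (Σ-const n (trace X)) ⟩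
    (fromℕ n * trace X + fromℕ n * trace X) - 0ℚ
      ≡⟨ ℚ.+-identityʳ (fromℕ n * trace X + fromℕ n * trace X) ⟩
    fromℕ n * trace X + fromℕ n * trace X
      ∎)
    where
    columns : Σ n (λ u → Σ n (λ v → X v u)) ≡ 0ℚ
    columns = trans (sym (Σ-comm n n X)) (trans (Σ-cong n rows) (Σ-zero n))
    halve : ∀ {x y} → x + x ≡ y + y → x ≡ y
    halve {x} {y} eq = trans (double x) (trans (cong (½ *_) eq) (sym (double y)))
      where
      double : ∀ z → z ≡ ½ * (z + z)
      double = solve-∀ ℚ-ring

  module Doubling {m : ℕ} (H : Fin m → Fin m → Bool) where

    block : Fin (m ℕ.* 2) → Fin m
    block i = proj₁ (remQuot {m} 2 i)

    twin : Fin (m ℕ.* 2) → Fin 2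
    twin i = proj₂ (remQuot {m} 2 i)

    adjacency : Fin (m ℕ.* 2) → Fin (m ℕ.* 2) → Bool
    adjacency i j = H (block i) (block j)

    block-combine : ∀ (k : Fin m) (b : Fin 2) → block (combine k b) ≡ k
    block-combine k b = cong proj₁ (Fin.remQuot-combine k b)

    twin-combine : ∀ (k : Fin m) (b : Fin 2) → twin (combine k b) ≡ b
    twin-combine k b = cong proj₂ (Fin.remQuot-combine k b)

    e-blocks : ∀ i j → e i j ≡ e (block i) (block j) * e (twin i) (twin j)
    e-blocks i j = begin
      e i j
        ≡⟨ e-does i j ⟩
      b2q ⌊ i Fin.≟ j ⌋
        ≡⟨ cong b2q (⌊⌋-⇔ (mk⇔ components combined) (i Fin.≟ j) (block i Fin.≟ block j ×-dec twin i Fin.≟ twin j)) ⟩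
      b2q ⌊ block i Fin.≟ block j ×-dec twin i Fin.≟ twin j ⌋
        ≡⟨ b2q-×-dec (block i Fin.≟ block j) (twin i Fin.≟ twin j) ⟩
      b2q ⌊ block i Fin.≟ block j ⌋ * b2q ⌊ twin i Fin.≟ twin j ⌋
        ≡⟨ sym (cong₂ _*_ (e-does (block i) (block j)) (e-does (twin i) (twin j))) ⟩
      e (block i) (block j) * e (twin i) (twin j)
        ∎
      where
      components : i ≡ j → block i ≡ block j × twin i ≡ twin j
      components refl = refl , refl
      combined : block i ≡ block j × twin i ≡ twin j → i ≡ j
      combined (p , q) = trans (sym (Fin.combine-remQuot {m} 2 i)) (trans (cong₂ combine p q) (Fin.combine-remQuot {m} 2 j))

    Σ-adjacency : ∀ i (g : Fin (m ℕ.* 2) → ℚ) →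
      Σ (m ℕ.* 2) (λ l → b2q (adjacency i l) * g l) ≡ Σ m (λ k → b2q (H (block i) k) * Σ 2 (λ b → g (combine k b)))
    Σ-adjacency i g = trans (Σ-combine m 2 (λ l → b2q (adjacency i l) * g l)) (Σ-cong m (λ k →
      trans (Σ-cong 2 (λ b → cong (λ c → b2q (H (block i) c) * g (combine k b)) (block-combine k b)))
            (sym (*-distribˡ-Σ 2 (b2q (H (block i) k)) (λ b → g (combine k b))))))

    module Inverse (d : ℚ) .{{_ : ℚ.NonZero d}} (F : Matrix m) where

      -- The Laplacian of the doubled graph is 2 L_H ⊗ ½J₂ + 2d I ⊗ (I₂ − ½J₂); inverting it on the two
      -- complementary projections gives this kernel when F is the pseudo-inverse of L_H.
      kernel : Fin m → Fin m → Fin 2 → Fin 2 → ℚ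
      kernel a c b b′ = ½ * (½ * F a c + e a c * (e b b′ - ½) * 1/ d)

      inverse : Matrix (m ℕ.* 2)
      inverse i j = kernel (block i) (block j) (twin i) (twin j)

      Σ-twins-kernel : ∀ a c b′ → Σ 2 (λ b → kernel a c b b′) ≡ ½ * F a c
      Σ-twins-kernel a c zero       = twins-cancel (F a c) (e a c) (1/ d)
        where
        twins-cancel : ∀ f δ r → ½ * (½ * f + δ * (1ℚ - ½) * r) + (½ * (½ * f + δ * (0ℚ - ½) * r) + 0ℚ) ≡ ½ * f
        twins-cancel = solve-∀ ℚ-ring
      Σ-twins-kernel a c (suc zero) = twins-cancel (F a c) (e a c) (1/ d)
        where
        twins-cancel : ∀ f δ r → ½ * (½ * f + δ * (0ℚ - ½) * r) + (½ * (½ * f + δ * (1ℚ - ½) * r) + 0ℚ) ≡ ½ * f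
        twins-cancel = solve-∀ ℚ-ring

      Σ-twins-inverse : ∀ k j → Σ 2 (λ b → inverse (combine k b) j) ≡ ½ * F k (block j)
      Σ-twins-inverse k j = trans
        (Σ-cong 2 (λ b → cong₂ (λ c b → kernel c (block j) b (twin j)) (block-combine k b) (twin-combine k b)))
        (Σ-twins-kernel k (block j) (twin j))

      inverse-diagonal : ∀ i → inverse i i ≡ ½ * (½ * F (block i) (block i) + ½ * 1/ d)
      inverse-diagonal i rewrite e-refl (block i) | e-refl (twin i) = diagonal (F (block i) (block i)) (1/ d)
        where
        diagonal : ∀ f r → ½ * (½ * f + 1ℚ * (1ℚ - ½) * r) ≡ ½ * (½ * f + ½ * r)
        diagonal = solve-∀ ℚ-ring

      module Penrose (w : ℚ) (H-irreflexive : ∀ a → H a a ≡ false) (H-symmetric : ∀ a c → H a c ≡ H c a)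
               (H-regular : ∀ a → degree H a ≡ d) (F-symmetric : transpose F ≈ F)
               (F-rows : ∀ a → Σ m (F a) ≡ 0ℚ) (F-green : laplacian H ⊗ F ≈ centring w) where

        inverse-symmetric : transpose inverse ≈ inverse
        inverse-symmetric i j = cong₂ (λ f x → ½ * (½ * f + x * 1/ d)) (F-symmetric (block i) (block j))
          (cong₂ (λ δ ε → δ * (ε - ½)) (e-sym (block j) (block i)) (e-sym (twin j) (twin i)))

        inverse-columns : ∀ j → Σ (m ℕ.* 2) (λ l → inverse l j) ≡ 0ℚ
        inverse-columns j = begin
          Σ (m ℕ.* 2) (λ l → inverse l j)                    ≡⟨ Σ-combine m 2 (λ l → inverse l j) ⟩
          Σ m (λ k → Σ 2 (λ b → inverse (combine k b) j))    ≡⟨ Σ-cong m (λ k → Σ-twins-inverse k j) ⟩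
          Σ m (λ k → ½ * F k (block j))                      ≡⟨ sym (*-distribˡ-Σ m ½ (λ k → F k (block j))) ⟩
          ½ * Σ m (λ k → F k (block j))                      ≡⟨ cong (½ *_) (Σ-cong m (F-symmetric (block j))) ⟩
          ½ * Σ m (F (block j))                              ≡⟨ cong (½ *_) (F-rows (block j)) ⟩
          ½ * 0ℚ                                             ≡⟨ ℚ.*-zeroʳ ½ ⟩
          0ℚ                                                 ∎

        inverse-rows : ∀ i → Σ (m ℕ.* 2) (inverse i) ≡ 0ℚ
        inverse-rows i = trans (Σ-cong (m ℕ.* 2) (λ l → inverse-symmetric l i)) (inverse-columns i)

        adjacency-irreflexive : ∀ i → adjacency i i ≡ false
        adjacency-irreflexive i = H-irreflexive (block i)

        laplacian-columns : ∀ j → Σ (m ℕ.* 2) (λ l → laplacian adjacency l j) ≡ 0ℚ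
        laplacian-columns j = trans (Σ-cong (m ℕ.* 2) (laplacian-symmetric adjacency (λ i j → H-symmetric (block i) (block j)) j))
                                    (laplacian-rows adjacency j (adjacency-irreflexive j))

        degree-adjacency : ∀ i → degree adjacency i ≡ d + d
        degree-adjacency i = begin
          Σ (m ℕ.* 2) (λ l → b2q (adjacency i l))                  ≡⟨ Σ-cong (m ℕ.* 2) (λ l → sym (ℚ.*-identityʳ _)) ⟩
          Σ (m ℕ.* 2) (λ l → b2q (adjacency i l) * 1ℚ)             ≡⟨ Σ-adjacency i (λ _ → 1ℚ) ⟩
          Σ m (λ k → b2q (H (block i) k) * (1ℚ + (1ℚ + 0ℚ)))       ≡⟨ Σ-cong m (λ k → twice (b2q (H (block i) k))) ⟩
          Σ m (λ k → b2q (H (block i) k) + b2q (H (block i) k))    ≡⟨ Σ-distrib-+ m _ _ ⟩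
          degree H (block i) + degree H (block i)                  ≡⟨ cong₂ _+_ (H-regular (block i)) (H-regular (block i)) ⟩
          d + d                                                    ∎
          where
          twice : ∀ x → x * (1ℚ + (1ℚ + 0ℚ)) ≡ x + x
          twice = solve-∀ ℚ-ring

        Σ-neighbours-F : ∀ a c → Σ m (λ k → b2q (H a k) * F k c) ≡ d * F a c - (e a c - w)
        Σ-neighbours-F a c = begin
          Σ m (λ k → b2q (H a k) * F k c)                             ≡⟨ rearrange (degree H a * F a c) (Σ m (λ k → b2q (H a k) * F k c)) ⟩
          degree H a * F a c - (degree H a * F a c - Σ m (λ k → b2q (H a k) * F k c))
            ≡⟨ cong₂ (λ x y → x * F a c - y) (H-regular a) (sym (Σ-laplacian H a (λ k → F k c) (H-irreflexive a))) ⟩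
          d * F a c - (laplacian H ⊗ F) a c                           ≡⟨ cong (_-_ (d * F a c)) (F-green a c) ⟩
          d * F a c - (e a c - w)                                     ∎
          where
          rearrange : ∀ x y → y ≡ x - (x - y)
          rearrange = solve-∀ ℚ-ring

        inverse-laplacian : laplacian adjacency ⊗ inverse ≈ centring (½ * w)
        inverse-laplacian i j = begin
          Σ (m ℕ.* 2) (λ l → laplacian adjacency i l * inverse l j)
            ≡⟨ Σ-laplacian adjacency i (λ l → inverse l j) (adjacency-irreflexive i) ⟩
          degree adjacency i * inverse i j - Σ (m ℕ.* 2) (λ l → b2q (adjacency i l) * inverse l j)
            ≡⟨ cong₂ (λ x y → x * inverse i j - y) (degree-adjacency i) (Σ-adjacency i (λ l → inverse l j)) ⟩
          (d + d) * inverse i j - Σ m (λ k → b2q (H a k) * Σ 2 (λ b → inverse (combine k b) j))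
            ≡⟨ cong (_-_ ((d + d) * inverse i j)) (Σ-cong m (λ k → cong (b2q (H a k) *_) (Σ-twins-inverse k j))) ⟩
          (d + d) * inverse i j - Σ m (λ k → b2q (H a k) * (½ * F k c))
            ≡⟨ cong (_-_ ((d + d) * inverse i j)) (Σ-cong m (λ k → *-comm-½ (b2q (H a k)) (F k c))) ⟩
          (d + d) * inverse i j - Σ m (λ k → ½ * (b2q (H a k) * F k c))
            ≡⟨ cong (_-_ ((d + d) * inverse i j)) (sym (*-distribˡ-Σ m ½ (λ k → b2q (H a k) * F k c))) ⟩
          (d + d) * inverse i j - ½ * Σ m (λ k → b2q (H a k) * F k c)
            ≡⟨ cong (λ s → (d + d) * inverse i j - ½ * s) (Σ-neighbours-F a c) ⟩
          (d + d) * inverse i j - ½ * (d * F a c - (e a c - w))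
            ≡⟨ cancel-degree (F a c) (e a c) (e (twin i) (twin j)) ⟩
          e a c * e (twin i) (twin j) - ½ * w
            ≡⟨ cong (_- ½ * w) (sym (e-blocks i j)) ⟩
          e i j - ½ * w
            ∎
          where
          a c : Fin m
          a = block i
          c = block j
          *-comm-½ : ∀ x y → x * (½ * y) ≡ ½ * (x * y)
          *-comm-½ = solve-∀ ℚ-ring
          expand : ∀ d r f δ ε w → (d + d) * (½ * (½ * f + δ * (ε - ½) * r)) - ½ * (d * f - (δ - w))
                                   ≡ δ * ε * (d * r) + ½ * δ * (1ℚ - d * r) - ½ * w
          expand = solve-∀ ℚ-ring
          simplify : ∀ δ ε w → δ * ε * 1ℚ + ½ * δ * (1ℚ - 1ℚ) - ½ * w ≡ δ * ε - ½ * w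
          simplify = solve-∀ ℚ-ring
          cancel-degree : ∀ f δ ε → (d + d) * (½ * (½ * f + δ * (ε - ½) * 1/ d)) - ½ * (d * f - (δ - w)) ≡ δ * ε - ½ * w
          cancel-degree f δ ε = begin
            (d + d) * (½ * (½ * f + δ * (ε - ½) * 1/ d)) - ½ * (d * f - (δ - w))
              ≡⟨ expand d (1/ d) f δ ε w ⟩
            δ * ε * (d * 1/ d) + ½ * δ * (1ℚ - d * 1/ d) - ½ * w
              ≡⟨ cong (λ x → δ * ε * x + ½ * δ * (1ℚ - x) - ½ * w) (ℚ.*-inverseʳ d) ⟩
            δ * ε * 1ℚ + ½ * δ * (1ℚ - 1ℚ) - ½ * w
              ≡⟨ simplify δ ε w ⟩
            δ * ε - ½ * w
              ∎

        inverse-isMoorePenrose : IsMoorePenrose (laplacian adjacency) inverse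
        inverse-isMoorePenrose = isMoorePenrose-centring (½ * w)
          (laplacian-symmetric adjacency (λ i j → H-symmetric (block i) (block j))) inverse-symmetric
          laplacian-columns inverse-columns inverse-laplacian

  module Cycle (k : ℕ) where

    m : ℕ
    m = 3 ℕ.+ k

    adjacency : Fin m → Fin m → Bool
    adjacency a c = ⌊ toℕ c ℕ.≟ suc (toℕ a) % m ⌋ ∨ ⌊ toℕ a ℕ.≟ suc (toℕ c) % m ⌋

    pred-mod : ℕ → ℕ
    pred-mod zero    = 2 ℕ.+ k
    pred-mod (suc x) = x

    suc-%-cases : ∀ {x} → x ℕ.< m → (suc x ℕ.< m × suc x % m ≡ suc x) ⊎ (suc x ≡ m × suc x % m ≡ 0)
    suc-%-cases x<m with ℕ.m≤n⇒m<n∨m≡n x<m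
    ... | inj₁ 1+x<m = inj₁ (1+x<m , m<n⇒m%n≡m 1+x<m)
    ... | inj₂ 1+x≡m = inj₂ (1+x≡m , trans (cong (_% m) 1+x≡m) (n%n≡0 m))

    pred-mod<m : ∀ {x} → x ℕ.< m → pred-mod x ℕ.< m
    pred-mod<m {zero}  _     = ℕ.n<1+n (2 ℕ.+ k)
    pred-mod<m {suc x} 1+x<m = ℕ.<-trans (ℕ.n<1+n x) 1+x<m

    suc-pred-mod : ∀ {x} → x ℕ.< m → suc (pred-mod x) % m ≡ x
    suc-pred-mod {zero}  _     = n%n≡0 m
    suc-pred-mod {suc x} 1+x<m = m<n⇒m%n≡m 1+x<m

    pred-mod-suc : ∀ {x} → x ℕ.< m → pred-mod (suc x % m) ≡ x
    pred-mod-suc x<m with suc-%-cases x<m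
    ... | inj₁ (_ , 1+x%m≡1+x) = cong pred-mod 1+x%m≡1+x
    ... | inj₂ (1+x≡m , 1+x%m≡0) = trans (cong pred-mod 1+x%m≡0) (ℕ.suc-injective (sym 1+x≡m))

    suc-%≢id : ∀ {x} → x ℕ.< m → suc x % m ≢ x
    suc-%≢id x<m with suc-%-cases x<m
    ... | inj₁ (_ , 1+x%m≡1+x) = λ eq → ℕ.m≢1+n+m _ {0} (trans (sym eq) 1+x%m≡1+x)
    ... | inj₂ (1+x≡m , 1+x%m≡0) = λ eq → 1≢m (trans (cong suc (trans (sym 1+x%m≡0) eq)) 1+x≡m)
      where
      1≢m : 1 ≢ m
      1≢m ()

    suc-%≢pred-mod : ∀ {x} → x ℕ.< m → suc x % m ≢ pred-mod x
    suc-%≢pred-mod {zero}  _ ()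
    suc-%≢pred-mod {suc x} 1+x<m with suc-%-cases 1+x<m
    ... | inj₁ (_ , 2+x%m≡2+x) = λ eq → ℕ.m≢1+n+m x {1} (trans (sym eq) 2+x%m≡2+x)
    ... | inj₂ (2+x≡m , 2+x%m≡0) = λ eq → 2≢m (trans (cong (λ y → suc (suc y)) (trans (sym 2+x%m≡0) eq)) 2+x≡m)
      where
      2≢m : 2 ≢ m
      2≢m ()

    next : Fin m → Fin m
    next a = fromℕ< (m%n<n (suc (toℕ a)) m)

    prev : Fin m → Fin m
    prev a = fromℕ< (pred-mod<m (Fin.toℕ<n a))

    toℕ-next : ∀ a → toℕ (next a) ≡ suc (toℕ a) % m
    toℕ-next a = Fin.toℕ-fromℕ< (m%n<n (suc (toℕ a)) m)

    toℕ-prev : ∀ a → toℕ (prev a) ≡ pred-mod (toℕ a)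
    toℕ-prev a = Fin.toℕ-fromℕ< (pred-mod<m (Fin.toℕ<n a))

    next≢prev : ∀ a → next a ≢ prev a
    next≢prev a eq = suc-%≢pred-mod (Fin.toℕ<n a) (trans (sym (toℕ-next a)) (trans (cong toℕ eq) (toℕ-prev a)))

    adjacency-next-prev : ∀ a c → b2q (adjacency a c) ≡ e (next a) c + e (prev a) c
    adjacency-next-prev a c = begin
      b2q (adjacency a c)
        ≡⟨ cong₂ (λ x y → b2q (x ∨ y)) (⌊⌋-⇔ (mk⇔ is-next from-next) (toℕ c ℕ.≟ suc (toℕ a) % m) (next a Fin.≟ c))
                                       (⌊⌋-⇔ (mk⇔ is-prev from-prev) (toℕ a ℕ.≟ suc (toℕ c) % m) (prev a Fin.≟ c)) ⟩
      b2q (⌊ next a Fin.≟ c ⌋ ∨ ⌊ prev a Fin.≟ c ⌋)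
        ≡⟨ b2q-∨ (next a Fin.≟ c) (prev a Fin.≟ c) (λ (p , q) → next≢prev a (trans p (sym q))) ⟩
      b2q ⌊ next a Fin.≟ c ⌋ + b2q ⌊ prev a Fin.≟ c ⌋
        ≡⟨ sym (cong₂ _+_ (e-does (next a) c) (e-does (prev a) c)) ⟩
      e (next a) c + e (prev a) c
        ∎
      where
      is-next : toℕ c ≡ suc (toℕ a) % m → next a ≡ c
      is-next eq = Fin.toℕ-injective (trans (toℕ-next a) (sym eq))
      from-next : next a ≡ c → toℕ c ≡ suc (toℕ a) % m
      from-next eq = trans (cong toℕ (sym eq)) (toℕ-next a)
      is-prev : toℕ a ≡ suc (toℕ c) % m → prev a ≡ c
      is-prev eq = Fin.toℕ-injective (trans (toℕ-prev a) (trans (cong pred-mod eq) (pred-mod-suc (Fin.toℕ<n c))))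
      from-prev : prev a ≡ c → toℕ a ≡ suc (toℕ c) % m
      from-prev eq = trans (sym (suc-pred-mod (Fin.toℕ<n a))) (cong (λ y → suc y % m) (trans (sym (toℕ-prev a)) (cong toℕ eq)))

    Σ-neighbours : ∀ a (g : Fin m → ℚ) → Σ m (λ c → b2q (adjacency a c) * g c) ≡ g (next a) + g (prev a)
    Σ-neighbours a g = begin
      Σ m (λ c → b2q (adjacency a c) * g c)
        ≡⟨ Σ-cong m (λ c → trans (cong (_* g c) (adjacency-next-prev a c)) (ℚ.*-distribʳ-+ (g c) (e (next a) c) (e (prev a) c))) ⟩
      Σ m (λ c → e (next a) c * g c + e (prev a) c * g c)
        ≡⟨ Σ-distrib-+ m (λ c → e (next a) c * g c) (λ c → e (prev a) c * g c) ⟩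
      Σ m (λ c → e (next a) c * g c) + Σ m (λ c → e (prev a) c * g c)
        ≡⟨ cong₂ _+_ (Σ-δ m (next a) g) (Σ-δ m (prev a) g) ⟩
      g (next a) + g (prev a)
        ∎

    adjacency-irreflexive : ∀ a → adjacency a a ≡ false
    adjacency-irreflexive a with toℕ a ℕ.≟ suc (toℕ a) % m
    ... | yes eq = ⊥-elim (suc-%≢id (Fin.toℕ<n a) (sym eq))
    ... | no _   = refl

    adjacency-symmetric : ∀ a c → adjacency a c ≡ adjacency c a
    adjacency-symmetric a c = ∨-comm ⌊ toℕ c ℕ.≟ suc (toℕ a) % m ⌋ ⌊ toℕ a ℕ.≟ suc (toℕ c) % m ⌋

    adjacency-regular : ∀ a → degree adjacency a ≡ 1ℚ + 1ℚ
    adjacency-regular a = trans (Σ-cong m (λ c → sym (ℚ.*-identityʳ (b2q (adjacency a c))))) (Σ-neighbours a (λ _ → 1ℚ))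

    M : ℚ
    M = fromℕ m

    w : ℚ
    w = 1/ M

    κ : ℚ
    κ = (M * M - 1ℚ) * (+ 1 / 12)

    p : ℚ → ℚ
    p t = (κ - ½ * t * (M - t)) * w

    P : ℕ → ℚ
    P t = p (fromℕ t)

    -- The pseudo-inverse of the Laplacian of Cₘ. The linear distance ∣a − c∣ can stand in for the
    -- cyclic one because p (M − t) ≡ p t.
    green : Matrix m
    green a c = P ∣ toℕ a - toℕ c ∣

    p-reflect : ∀ t → p (M - t) ≡ p t
    p-reflect t = reflect κ M w t
      where
      reflect : ∀ κ M w t → (κ - ½ * (M - t) * (M - (M - t))) * w ≡ (κ - ½ * t * (M - t)) * w
      reflect = solve-∀ ℚ-ring

    p-second-difference : ∀ t → p t + p (1ℚ + (1ℚ + t)) ≡ p (1ℚ + t) + p (1ℚ + t) + w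
    p-second-difference t = difference κ M w t
      where
      difference : ∀ κ M w t →
        (κ - ½ * t * (M - t)) * w + (κ - ½ * (1ℚ + (1ℚ + t)) * (M - (1ℚ + (1ℚ + t)))) * w
          ≡ (κ - ½ * (1ℚ + t) * (M - (1ℚ + t))) * w + (κ - ½ * (1ℚ + t) * (M - (1ℚ + t))) * w + w
      difference = solve-∀ ℚ-ring

    p-endpoint : p 1ℚ + p 1ℚ ≡ p 0ℚ + p 0ℚ + w - 1ℚ
    p-endpoint = begin
      p 1ℚ + p 1ℚ                  ≡⟨ endpoint κ M w ⟩
      p 0ℚ + p 0ℚ + w - M * w      ≡⟨ cong (_-_ (p 0ℚ + p 0ℚ + w)) (ℚ.*-inverseʳ M) ⟩
      p 0ℚ + p 0ℚ + w - 1ℚ         ∎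
      where
      endpoint : ∀ κ M w → (κ - ½ * 1ℚ * (M - 1ℚ)) * w + (κ - ½ * 1ℚ * (M - 1ℚ)) * w
                           ≡ (κ - ½ * 0ℚ * (M - 0ℚ)) * w + (κ - ½ * 0ℚ * (M - 0ℚ)) * w + w - M * w
      endpoint = solve-∀ ℚ-ring

    Σp : ℚ → ℚ
    Σp n = (n * κ - ½ * (M * n * (n - 1ℚ) * ½ - n * (n - 1ℚ) * (n + n - 1ℚ) * (+ 1 / 6))) * w

    Σp-step : ∀ n → Σp n + p n ≡ Σp (1ℚ + n)
    Σp-step n = step κ M w n
      where
      step : ∀ κ M w n →
        (n * κ - ½ * (M * n * (n - 1ℚ) * ½ - n * (n - 1ℚ) * (n + n - 1ℚ) * (+ 1 / 6))) * w + (κ - ½ * n * (M - n)) * w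
          ≡ ((1ℚ + n) * κ - ½ * (M * (1ℚ + n) * ((1ℚ + n) - 1ℚ) * ½
                                 - (1ℚ + n) * ((1ℚ + n) - 1ℚ) * ((1ℚ + n) + (1ℚ + n) - 1ℚ) * (+ 1 / 6))) * w
      step = solve-∀ ℚ-ring

    Σp-zero : Σp 0ℚ ≡ 0ℚ
    Σp-zero = vanish κ M w
      where
      vanish : ∀ κ M w → (0ℚ * κ - ½ * (M * 0ℚ * (0ℚ - 1ℚ) * ½ - 0ℚ * (0ℚ - 1ℚ) * (0ℚ + 0ℚ - 1ℚ) * (+ 1 / 6))) * w ≡ 0ℚ
      vanish = solve-∀ ℚ-ring

    Σp-full : Σp M ≡ 0ℚ
    Σp-full = vanish M w
      where
      vanish : ∀ M w → (M * ((M * M - 1ℚ) * (+ 1 / 12))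
                          - ½ * (M * M * (M - 1ℚ) * ½ - M * (M - 1ℚ) * (M + M - 1ℚ) * (+ 1 / 6))) * w ≡ 0ℚ
      vanish = solve-∀ ℚ-ring

    P-reflect : ∀ s t → s ℕ.+ t ≡ m → P s ≡ P t
    P-reflect s t s+t≡m = trans (cong p s≡M-t) (p-reflect (fromℕ t))
      where
      add-sub : ∀ x y → x ≡ (x + y) - y
      add-sub = solve-∀ ℚ-ring
      s≡M-t : fromℕ s ≡ M - fromℕ t
      s≡M-t = trans (add-sub (fromℕ s) (fromℕ t)) (cong (_- fromℕ t) (trans (sym (fromℕ-+ s t)) (cong fromℕ s+t≡m)))

    P-reflect-∣-∣ : ∀ {n y} s → y ℕ.≤ n → n ℕ.+ s ≡ m → P ∣ n - y ∣ ≡ P (s ℕ.+ y)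
    P-reflect-∣-∣ {n} {y} s y≤n n+s≡m = P-reflect ∣ n - y ∣ (s ℕ.+ y) (begin
      ∣ n - y ∣ ℕ.+ (s ℕ.+ y)   ≡⟨ cong₂ ℕ._+_ (ℕ.m≤n⇒∣n-m∣≡n∸m y≤n) (ℕ.+-comm s y) ⟩
      (n ∸ y) ℕ.+ (y ℕ.+ s)     ≡⟨ sym (ℕ.+-assoc (n ∸ y) y s) ⟩
      (n ∸ y) ℕ.+ y ℕ.+ s       ≡⟨ cong (ℕ._+ s) (ℕ.m∸n+n≡m y≤n) ⟩
      n ℕ.+ s                   ≡⟨ n+s≡m ⟩
      m                         ∎)

    P-second-difference : ∀ t → P t + P (2 ℕ.+ t) ≡ P (1 ℕ.+ t) + P (1 ℕ.+ t) + w
    P-second-difference t = begin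
      P t + P (2 ℕ.+ t)                              ≡⟨ cong (λ x → P t + p x) (trans (fromℕ-suc (suc t)) (cong (_+_ 1ℚ) (fromℕ-suc t))) ⟩
      p (fromℕ t) + p (1ℚ + (1ℚ + fromℕ t))          ≡⟨ p-second-difference (fromℕ t) ⟩
      p (1ℚ + fromℕ t) + p (1ℚ + fromℕ t) + w        ≡⟨ cong (λ x → p x + p x + w) (sym (fromℕ-suc t)) ⟩
      P (1 ℕ.+ t) + P (1 ℕ.+ t) + w                  ∎

    P-∣-∣-second-difference : ∀ x y → P ∣ x - y ∣ + P ∣ suc (suc x) - y ∣ ≡ P ∣ suc x - y ∣ + P ∣ suc x - y ∣ + w - b2q ⌊ suc x ℕ.≟ y ⌋
    P-∣-∣-second-difference zero          zero          = trans (P-second-difference 0) (sym (ℚ.+-identityʳ _))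
    P-∣-∣-second-difference (suc x)       zero          = trans (P-second-difference (suc x)) (sym (ℚ.+-identityʳ _))
    P-∣-∣-second-difference zero          (suc zero)    = p-endpoint
    P-∣-∣-second-difference zero          (suc (suc y)) = trans (ℚ.+-comm (P (suc (suc y))) (P y)) (trans (P-second-difference y) (sym (ℚ.+-identityʳ _)))
    P-∣-∣-second-difference (suc x)       (suc y)       = trans (P-∣-∣-second-difference x y) (cong (λ b → P ∣ suc x - y ∣ + P ∣ suc x - y ∣ + w - b2q b) (sym (⌊suc≟suc⌋ (suc x) y)))

    P-∣-∣-second-difference-cyclic : ∀ {x y} → x ℕ.< m → y ℕ.< m →
      P ∣ suc x % m - y ∣ + P ∣ pred-mod x - y ∣ ≡ P ∣ x - y ∣ + P ∣ x - y ∣ + w - b2q ⌊ x ℕ.≟ y ⌋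
    P-∣-∣-second-difference-cyclic {zero} {y} _ y<m = begin
      P ∣ 1 - y ∣ + P ∣ 2 ℕ.+ k - y ∣    ≡⟨ cong (_+_ (P ∣ 1 - y ∣)) (P-reflect-∣-∣ 1 (ℕ.s≤s⁻¹ y<m) (ℕ.+-comm (2 ℕ.+ k) 1)) ⟩
      P ∣ 1 - y ∣ + P (suc y)            ≡⟨ ℚ.+-comm (P ∣ 1 - y ∣) (P (suc y)) ⟩
      P (suc y) + P ∣ 1 - y ∣            ≡⟨ P-∣-∣-second-difference 0 (suc y) ⟩
      P y + P y + w - b2q ⌊ 1 ℕ.≟ suc y ⌋ ≡⟨ cong (λ b → P y + P y + w - b2q b) (⌊suc≟suc⌋ 0 y) ⟩
      P y + P y + w - b2q ⌊ 0 ℕ.≟ y ⌋    ∎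
    P-∣-∣-second-difference-cyclic {suc x} {y} 1+x<m y<m with suc-%-cases 1+x<m
    ... | inj₁ (_ , 2+x%m≡2+x) rewrite 2+x%m≡2+x = trans (ℚ.+-comm (P ∣ suc (suc x) - y ∣) (P ∣ x - y ∣)) (P-∣-∣-second-difference x y)
    ... | inj₂ (2+x≡m , 2+x%m≡0) rewrite 2+x%m≡0 = begin
      P y + P ∣ x - y ∣                   ≡⟨ cong (_+ P ∣ x - y ∣) (sym (P-reflect-∣-∣ 0 y≤2+x (trans (ℕ.+-identityʳ _) 2+x≡m))) ⟩
      P ∣ suc (suc x) - y ∣ + P ∣ x - y ∣ ≡⟨ ℚ.+-comm (P ∣ suc (suc x) - y ∣) (P ∣ x - y ∣) ⟩
      P ∣ x - y ∣ + P ∣ suc (suc x) - y ∣ ≡⟨ P-∣-∣-second-difference x y ⟩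
      P ∣ suc x - y ∣ + P ∣ suc x - y ∣ + w - b2q ⌊ suc x ℕ.≟ y ⌋ ∎
      where
      y≤2+x : y ℕ.≤ suc (suc x)
      y≤2+x = ℕ.<⇒≤ (subst (y ℕ.<_) (sym 2+x≡m) y<m)

    green-second-difference : ∀ a c → green (next a) c + green (prev a) c ≡ green a c + green a c + w - e a c
    green-second-difference a c = begin
      green (next a) c + green (prev a) c
        ≡⟨ cong₂ (λ x y → P ∣ x - toℕ c ∣ + P ∣ y - toℕ c ∣) (toℕ-next a) (toℕ-prev a) ⟩
      P ∣ suc (toℕ a) % m - toℕ c ∣ + P ∣ pred-mod (toℕ a) - toℕ c ∣
        ≡⟨ P-∣-∣-second-difference-cyclic (Fin.toℕ<n a) (Fin.toℕ<n c) ⟩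
      green a c + green a c + w - b2q ⌊ toℕ a ℕ.≟ toℕ c ⌋
        ≡⟨ cong (_-_ (green a c + green a c + w)) (sym (e-toℕ a c)) ⟩
      green a c + green a c + w - e a c
        ∎

    green-laplacian : laplacian adjacency ⊗ green ≈ centring w
    green-laplacian a c = begin
      Σ m (λ l → laplacian adjacency a l * green l c)
        ≡⟨ Σ-laplacian adjacency a (λ l → green l c) (adjacency-irreflexive a) ⟩
      degree adjacency a * green a c - Σ m (λ l → b2q (adjacency a l) * green l c)
        ≡⟨ cong₂ (λ d s → d * green a c - s) (adjacency-regular a) (Σ-neighbours a (λ l → green l c)) ⟩
      (1ℚ + 1ℚ) * green a c - (green (next a) c + green (prev a) c)
        ≡⟨ cong (_-_ ((1ℚ + 1ℚ) * green a c)) (green-second-difference a c) ⟩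
      (1ℚ + 1ℚ) * green a c - (green a c + green a c + w - e a c)
        ≡⟨ cancel (green a c) w (e a c) ⟩
      e a c - w
        ∎
      where
      cancel : ∀ g w δ → (1ℚ + 1ℚ) * g - (g + g + w - δ) ≡ δ - w
      cancel = solve-∀ ℚ-ring

    green-symmetric : transpose green ≈ green
    green-symmetric a c = cong P (ℕ.∣-∣-comm (toℕ c) (toℕ a))

    green-diagonal : ∀ a → green a a ≡ p 0ℚ
    green-diagonal a = cong P (ℕ.∣n-n∣≡0 (toℕ a))

    Σ-P : ∀ n → Σ n (λ c → P (toℕ c)) ≡ Σp (fromℕ n)
    Σ-P zero    = sym Σp-zero
    Σ-P (suc n) = begin
      Σ (suc n) (λ c → P (toℕ c))       ≡⟨ Σ-toℕ-last n P ⟩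
      Σ n (λ c → P (toℕ c)) + P n       ≡⟨ cong (_+ P n) (Σ-P n) ⟩
      Σp (fromℕ n) + p (fromℕ n)        ≡⟨ Σp-step (fromℕ n) ⟩
      Σp (1ℚ + fromℕ n)                 ≡⟨ cong Σp (sym (fromℕ-suc n)) ⟩
      Σp (fromℕ (suc n))                ∎

    row-sum : ℕ → ℚ
    row-sum x = Σ m (λ c → P ∣ x - toℕ c ∣)

    -- Moving x up by one trades the term at c = m − 1 for the one at c = 0, which agree by reflection.
    row-sum-shift : ∀ {x} → suc x ℕ.< m → row-sum (suc x) ≡ row-sum x
    row-sum-shift {x} 1+x<m = begin
      P (suc x) + Σ (2 ℕ.+ k) (λ c → P ∣ x - toℕ c ∣)     ≡⟨ ℚ.+-comm (P (suc x)) _ ⟩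
      Σ (2 ℕ.+ k) (λ c → P ∣ x - toℕ c ∣) + P (suc x)     ≡⟨ cong (_+_ (Σ (2 ℕ.+ k) (λ c → P ∣ x - toℕ c ∣))) (sym last-term) ⟩
      Σ (2 ℕ.+ k) (λ c → P ∣ x - toℕ c ∣) + P ∣ x - 2 ℕ.+ k ∣  ≡⟨ sym (Σ-toℕ-last (2 ℕ.+ k) (λ t → P ∣ x - t ∣)) ⟩
      row-sum x                                               ∎
      where
      last-term : P ∣ x - 2 ℕ.+ k ∣ ≡ P (suc x)
      last-term = trans (cong P (ℕ.∣-∣-comm x (2 ℕ.+ k)))
        (P-reflect-∣-∣ 1 (ℕ.<⇒≤ (ℕ.s≤s⁻¹ 1+x<m)) (ℕ.+-comm (2 ℕ.+ k) 1))

    row-sum-vanishes : ∀ {x} → x ℕ.< m → row-sum x ≡ 0ℚ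
    row-sum-vanishes {zero}  _     = trans (Σ-P m) Σp-full
    row-sum-vanishes {suc x} 1+x<m = trans (row-sum-shift 1+x<m) (row-sum-vanishes (ℕ.<-trans (ℕ.n<1+n x) 1+x<m))

    green-rows : ∀ a → Σ m (green a) ≡ 0ℚ
    green-rows a = row-sum-vanishes (Fin.toℕ<n a)


  module DoubledCycle (k : ℕ) where
    open Cycle k
    open Doubling adjacency using (block; module Inverse)
    open Inverse (1ℚ + 1ℚ) green public using (inverse; inverse-diagonal; module Penrose)
    open Penrose w adjacency-irreflexive adjacency-symmetric adjacency-regular green-symmetric green-rows green-laplacian
      public using (inverse-isMoorePenrose; inverse-rows)

    diagonal-entry : ℚ
    diagonal-entry = ½ * (½ * p 0ℚ + ½ * 1/ (1ℚ + 1ℚ))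

    trace-inverse : trace inverse ≡ fromℕ (m ℕ.* 2) * diagonal-entry
    trace-inverse = trans (Σ-cong (m ℕ.* 2) diagonal) (Σ-const (m ℕ.* 2) diagonal-entry)
      where
      diagonal : ∀ i → inverse i i ≡ diagonal-entry
      diagonal i = trans (inverse-diagonal i) (cong (λ f → ½ * (½ * f + ½ * 1/ (1ℚ + 1ℚ))) (green-diagonal (block i)))

    kirchhoff-arithmetic : fromℕ (m ℕ.* 2) * (fromℕ (m ℕ.* 2) * diagonal-entry) ≡ (+ (m ℕ.^ 3 ℕ.+ 6 ℕ.* m ℕ.^ 2) ℤ.- + m) / 12
    kirchhoff-arithmetic = begin
      fromℕ (m ℕ.* 2) * (fromℕ (m ℕ.* 2) * diagonal-entry)
        ≡⟨ cong (λ x → x * (x * diagonal-entry)) (fromℕ-* m 2) ⟩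
      M * fromℕ 2 * (M * fromℕ 2 * diagonal-entry)
        ≡⟨ expand M w ⟩
      (M * (M * M) - M) * (+ 1 / 12) * (M * w) + M * M * ½
        ≡⟨ cong (λ x → (M * (M * M) - M) * (+ 1 / 12) * x + M * M * ½) (ℚ.*-inverseʳ M) ⟩
      (M * (M * M) - M) * (+ 1 / 12) * 1ℚ + M * M * ½
        ≡⟨ collect M ⟩
      (M * (M * (M * 1ℚ)) + fromℕ 6 * (M * (M * 1ℚ)) - M) * (+ 1 / 12)
        ≡⟨ cong (λ x → (x - M) * (+ 1 / 12)) (sym cubic) ⟩
      (fromℕ (m ℕ.^ 3 ℕ.+ 6 ℕ.* m ℕ.^ 2) - fromℕ m) * (+ 1 / 12)
        ≡⟨ cong (_* (+ 1 / 12)) (sym (fromℤ-sub (+ (m ℕ.^ 3 ℕ.+ 6 ℕ.* m ℕ.^ 2)) (+ m))) ⟩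
      fromℤ (+ (m ℕ.^ 3 ℕ.+ 6 ℕ.* m ℕ.^ 2) ℤ.- + m) * (+ 1 / 12)
        ≡⟨ sym (/-as-* (+ (m ℕ.^ 3 ℕ.+ 6 ℕ.* m ℕ.^ 2) ℤ.- + m) 11) ⟩
      (+ (m ℕ.^ 3 ℕ.+ 6 ℕ.* m ℕ.^ 2) ℤ.- + m) / 12
        ∎
      where
      expand : ∀ M w → M * fromℕ 2 * (M * fromℕ 2 * (½ * (½ * (((M * M - 1ℚ) * (+ 1 / 12) - ½ * 0ℚ * (M - 0ℚ)) * w)
                                                            + ½ * 1/ (1ℚ + 1ℚ))))
                       ≡ (M * (M * M) - M) * (+ 1 / 12) * (M * w) + M * M * ½
      expand = solve-∀ ℚ-ring
      collect : ∀ M → (M * (M * M) - M) * (+ 1 / 12) * 1ℚ + M * M * ½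
                      ≡ (M * (M * (M * 1ℚ)) + fromℕ 6 * (M * (M * 1ℚ)) - M) * (+ 1 / 12)
      collect = solve-∀ ℚ-ring
      square : fromℕ (m ℕ.^ 2) ≡ M * (M * 1ℚ)
      square = trans (fromℕ-* m (m ℕ.^ 1)) (cong (_*_ M) (fromℕ-* m 1))
      cubic : fromℕ (m ℕ.^ 3 ℕ.+ 6 ℕ.* m ℕ.^ 2) ≡ M * (M * (M * 1ℚ)) + fromℕ 6 * (M * (M * 1ℚ))
      cubic = trans (fromℕ-+ (m ℕ.^ 3) (6 ℕ.* m ℕ.^ 2))
        (cong₂ _+_ (trans (fromℕ-* m (m ℕ.^ 2)) (cong (_*_ M) square)) (trans (fromℕ-* 6 (m ℕ.^ 2)) (cong (_*_ (fromℕ 6)) square)))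

    kirchhoff-inverse : kirchhoff inverse ≡ (+ (m ℕ.^ 3 ℕ.+ 6 ℕ.* m ℕ.^ 2) ℤ.- + m) / 12
    kirchhoff-inverse = begin
      kirchhoff inverse                                      ≡⟨ kirchhoff-trace inverse inverse-rows ⟩
      fromℕ (m ℕ.* 2) * trace inverse                        ≡⟨ cong (_*_ (fromℕ (m ℕ.* 2))) trace-inverse ⟩
      fromℕ (m ℕ.* 2) * (fromℕ (m ℕ.* 2) * diagonal-entry)   ≡⟨ kirchhoff-arithmetic ⟩
      (+ (m ℕ.^ 3 ℕ.+ 6 ℕ.* m ℕ.^ 2) ℤ.- + m) / 12           ∎

open import Data.Nat using (ℕ; _≤_; _+_; _*_; _^_)
open import Data.Integer using (+_; _-_)
open import Data.Rational using (ℚ; _/_)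
open import Data.Product using (Σ-syntax; _×_)
open import Relation.Binary.PropositionalEquality using (_≡_)
open import Data.Nat using (suc; s≤s; z≤n)
open import Data.Product using (_,_)

theorem4p1 : (m : ℕ) → (h : 3 ≤ m) →
    Σ[ X ∈ Matrix (m * 2) ] (IsMoorePenrose (Γ-laplacian m h) X ×
      kirchhoff X ≡ (+ (m ^ 3 + 6 * m ^ 2) - + m) / 12)
theorem4p1 (suc (suc (suc k))) (s≤s (s≤s (s≤s z≤n))) = inverse , inverse-isMoorePenrose , kirchhoff-inverse
  where
  open DoubledCycle k
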